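{- Let $n\ge0$, $\nu=\lfloor n/2\rfloor$ and $\mathcal H=(h_0,\ldots,h_\nu)$ with $h_r\ge 0$ integers. The number $m_{\mathcal H}^{(n)}$ of Motzkin paths of length $n$ in which each horizontal step at height $r$ is colored with one of $h_r$ colors is $$m_{\mathcal H}^{(n)}=\sum_{j=0}^{\nu}\sum_{\mathbf I\in I_{2j}}p^{2j}_{\mathbf I}\sum_{k_0+\cdots+k_\nu=n-2j}\binom{k_0+i_0-1}{k_0}\cdots\binom{k_\nu+i_\nu-1}{k_\nu}h_0^{k_0}\cdots h_\nu^{k_\nu},$$ where $I_{2j}$ is the set of frames of Dyck paths of length $2j$, $\mathbf I=(i_0,i_1,\ldots)$, $p^{2j}_{\mathbf I}$ is the number of Dyck paths with frame $\mathbf I$, and the inner sum is over nonnegative integers $k_0,\ldots,k_\nu$.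
   Context: A Motzkin path of length $n$ is a lattice path with $n$ steps from $(0,0)$ to $(n,0)$ using steps $(1,1)$, $(1,0)$, $(1,-1)$ that never goes below the $x$-axis. A Dyck path is a Motzkin path with no $(1,0)$ steps. The frame of a Dyck path is the eventually zero sequence $(i_0,i_1,\ldots)$ where $i_k$ is the number of vertices (including endpoints) at height $k$. Conventions: $\binom{k+i-1}{k}$ (the number of weak compositions of $k$ into $i$ parts) equals $0$ when $i=0$ and $k>0$, and equals $1$ when $k=0$; $h^0=1$ even if $h=0$. -}

module Defs where

open import Data.Bool using (Bool; true; false; _∧_; if_then_else_)
open import Data.Nat using (ℕ; zero; suc; _+_; _*_; _∸_; _^_; _≡ᵇ_; _⊔_; _/_)
open import Data.Nat.Combinatorics using (_C_)
open import Data.List using (List; []; _∷_; map; filter; filterᵇ; upTo; length; concatMap; foldr; all)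
open import Data.Nat.ListAction using (sum; product)

-- Steps of a lattice path: U = (1,1), H = (1,0), D = (1,-1).
data Step : Set where
  U H D : Step

allWords : ℕ → List (List Step)
allWords zero = [] ∷ []
allWords (suc n) = concatMap (λ w → (U ∷ w) ∷ (H ∷ w) ∷ (D ∷ w) ∷ []) (allWords n)

validFrom : ℕ → List Step → Bool
validFrom h [] = h ≡ᵇ 0
validFrom h (U ∷ w) = validFrom (suc h) w
validFrom h (H ∷ w) = validFrom h w
validFrom zero (D ∷ w) = false
validFrom (suc h) (D ∷ w) = validFrom h w

isMotzkin : List Step → Bool
isMotzkin = validFrom 0

noH : List Step → Bool
noH = all (λ { H → false ; _ → true })

isDyck : List Step → Bool
isDyck w = isMotzkin w ∧ noH w

motzkinPaths : ℕ → List (List Step)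
motzkinPaths n = filterᵇ isMotzkin (allWords n)

dyckPaths : ℕ → List (List Step)
dyckPaths n = filterᵇ isDyck (allWords n)

-- Entry r of a finite sequence, with default 0 past the end
-- (represents an eventually zero sequence).
at : List ℕ → ℕ → ℕ
at [] _ = 0
at (x ∷ xs) zero = x
at (x ∷ xs) (suc r) = at xs r

colorings : List ℕ → ℕ → List Step → ℕ
colorings hs h [] = 1
colorings hs h (U ∷ w) = colorings hs (suc h) w
colorings hs h (H ∷ w) = at hs h * colorings hs h w
colorings hs h (D ∷ w) = colorings hs (h ∸ 1) w

coloredMotzkin : ℕ → List ℕ → ℕ
coloredMotzkin n hs = sum (map (colorings hs 0) (motzkinPaths n))

vertexHeights : ℕ → List Step → List ℕ
vertexHeights h [] = h ∷ []
vertexHeights h (U ∷ w) = h ∷ vertexHeights (suc h) w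
vertexHeights h (H ∷ w) = h ∷ vertexHeights h w
vertexHeights h (D ∷ w) = h ∷ vertexHeights (h ∸ 1) w

countEq : ℕ → List ℕ → ℕ
countEq k xs = length (filterᵇ (λ x → k ≡ᵇ x) xs)

maxL : List ℕ → ℕ
maxL = foldr _⊔_ 0

-- Frame (i_0, i_1, ...) of a path, i_k = number of vertices at height k;
-- represented by its prefix up to the maximal height (all later entries are 0).
frame : List Step → List ℕ
frame w = map (λ k → countEq k hs) (upTo (suc (maxL hs)))
  where hs = vertexHeights 0 w

eqList : List ℕ → List ℕ → Bool
eqList [] [] = true
eqList (x ∷ xs) (y ∷ ys) = (x ≡ᵇ y) ∧ eqList xs ys
eqList _ _ = false

dedup : List (List ℕ) → List (List ℕ)
dedup [] = []
dedup (x ∷ xs) = x ∷ filterᵇ (λ y → if eqList x y then false else true) (dedup xs)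

frames : ℕ → List (List ℕ)
frames m = dedup (map frame (dyckPaths m))

pCount : ℕ → List ℕ → ℕ
pCount m I = length (filterᵇ (λ w → eqList (frame w) I) (dyckPaths m))

weakComps : ℕ → ℕ → List (List ℕ)
weakComps zero zero = [] ∷ []
weakComps zero (suc s) = []
weakComps (suc p) s = concatMap (λ k → map (k ∷_) (weakComps p (s ∸ k))) (upTo (suc s))

-- binom(k+i-1, k) with the stated conventions (1 if k = 0; 0 if i = 0, k > 0).
multichoose : ℕ → ℕ → ℕ
multichoose k zero = if k ≡ᵇ 0 then 1 else 0
multichoose k (suc i) = (k + i) C k

innerTerm : List ℕ → List ℕ → List ℕ → ℕ
innerTerm hs I ks =
  product (map (λ r → multichoose (at ks r) (at I r) * at hs r ^ at ks r) (upTo (length ks)))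

formulaRHS : ℕ → List ℕ → ℕ
formulaRHS n hs =
  sum (map (λ j →
    sum (map (λ I →
      pCount (2 * j) I *
      sum (map (innerTerm hs I) (weakComps (suc (n / 2)) (n ∸ 2 * j))))
      (frames (2 * j))))
    (upTo (suc (n / 2))))

module Submission where

-- Deleting the horizontal steps of a Motzkin path leaves a Dyck path w; conversely
-- a Motzkin path of length n over w arises by inserting n - |w| horizontal steps
-- at the vertices of w, a vertex at height r receiving k_r steps, each with h_r
-- colours.  In generating-function language (series in x, coefficients in ℕ) the
-- coloured insertions over w are counted by the product over the vertices v of
-- 1/(1 - h_{ht v} x), which equals  ∏_r (1 - h_r x)^(-i_r)  for the frame (i_r)
-- of w; its coefficients are the inner sums over weak compositions in the formula.
--
-- The combinatorial core shows that both sides, refined by a starting height,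
-- satisfy the first-step recurrence  M_h(n+1) = M_{h+1}(n) + h_h M_h(n) + M_{h-1}(n).
-- Finally Dyck paths of odd length do not exist, which reindexes the sum over
-- lengths ℓ ≤ n to the even lengths 2j, j ≤ ⌊n/2⌋, of the stated formula.

open import Defs
open import Data.Bool using (Bool; true; false; _∧_; if_then_else_; not; T)
open import Data.Bool.Properties using (∧-zeroʳ; not-involutive)
open import Data.List using (List; []; _∷_; map; filterᵇ; upTo; applyUpTo; length; concatMap; _++_)
open import Data.List.Membership.Propositional using (_∈_)
open import Data.List.Membership.Propositional.Properties using (∈-map⁺)
open import Data.List.Properties using (map-++; map-applyUpTo)
open import Data.List.Relation.Unary.Any using (here; there)
open import Data.Nat
open import Data.Nat.Combinatorics using (_C_; nCn≡1; nCk+nC[k+1]≡[n+1]C[k+1])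
open import Data.Nat.DivMod using (m/n≡1+[m∸n]/n)
open import Data.Nat.ListAction using (sum; product)
open import Data.Nat.ListAction.Properties using (sum-++)
open import Data.Nat.Properties
open import Algebra.Properties.CommutativeSemigroup +-commutativeSemigroup
  renaming (interchange to +-interchange) using ()
open import Data.Nat.Tactic.RingSolver using (solve-∀)
open import Data.Empty using (⊥-elim)
open import Data.Unit using (tt)
open import Data.Vec using (Vec; toList)
open import Data.Vec.Properties using (length-toList)
open import Relation.Binary.PropositionalEquality
open import Relation.Nullary using (yes; no)
open ≡-Reasoning

∑ : {A : Set} → List A → (A → ℕ) → ℕ
∑ L F = sum (map F L)

infix 5 ∑
syntax ∑ L (λ x → e) = ∑[ x ← L ] e

module _ {A : Set} where

  ∑-cong : ∀ {F G : A → ℕ} L → (∀ x → F x ≡ G x) → ∑ L F ≡ ∑ L G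
  ∑-cong [] e = refl
  ∑-cong (x ∷ L) e = cong₂ _+_ (e x) (∑-cong L e)

  ∑-cong∈ : ∀ {F G : A → ℕ} L → (∀ x → x ∈ L → F x ≡ G x) → ∑ L F ≡ ∑ L G
  ∑-cong∈ [] e = refl
  ∑-cong∈ (x ∷ L) e = cong₂ _+_ (e x (here refl)) (∑-cong∈ L (λ y y∈L → e y (there y∈L)))

  ∑-zero : ∀ (L : List A) → ∑[ x ← L ] 0 ≡ 0
  ∑-zero [] = refl
  ∑-zero (x ∷ L) = ∑-zero L

  ∑-+ : ∀ (F G : A → ℕ) L → ∑[ x ← L ] (F x + G x) ≡ ∑ L F + ∑ L G
  ∑-+ F G [] = refl
  ∑-+ F G (x ∷ L) rewrite ∑-+ F G L = +-interchange (F x) (G x) (∑ L F) (∑ L G)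

  ∑-*ˡ : ∀ a (F : A → ℕ) L → ∑[ x ← L ] (a * F x) ≡ a * ∑ L F
  ∑-*ˡ a F [] = sym (*-zeroʳ a)
  ∑-*ˡ a F (x ∷ L) rewrite ∑-*ˡ a F L = sym (*-distribˡ-+ a (F x) (∑ L F))

  ∑-filter : ∀ (F : A → ℕ) p L → ∑ (filterᵇ p L) F ≡ ∑[ x ← L ] (if p x then F x else 0)
  ∑-filter F p [] = refl
  ∑-filter F p (x ∷ L) with p x
  ... | true = cong (F x +_) (∑-filter F p L)
  ... | false = ∑-filter F p L

  length-filter : ∀ p (L : List A) → length (filterᵇ p L) ≡ ∑[ x ← L ] (if p x then 1 else 0)
  length-filter p [] = refl
  length-filter p (x ∷ L) with p x
  ... | true = cong suc (length-filter p L)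
  ... | false = length-filter p L

module _ {A B : Set} where

  ∑-map : ∀ (F : B → ℕ) (g : A → B) L → ∑ (map g L) F ≡ ∑[ x ← L ] F (g x)
  ∑-map F g [] = refl
  ∑-map F g (x ∷ L) = cong (F (g x) +_) (∑-map F g L)

  ∑-concatMap : ∀ (F : B → ℕ) (g : A → List B) L → ∑ (concatMap g L) F ≡ ∑[ x ← L ] ∑ (g x) F
  ∑-concatMap F g [] = refl
  ∑-concatMap F g (x ∷ L) = begin
    sum (map F (g x ++ concatMap g L))
      ≡⟨ cong sum (map-++ F (g x) (concatMap g L)) ⟩
    sum (map F (g x) ++ map F (concatMap g L))
      ≡⟨ sum-++ (map F (g x)) _ ⟩
    ∑ (g x) F + ∑ (concatMap g L) F
      ≡⟨ cong (∑ (g x) F +_) (∑-concatMap F g L) ⟩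
    ∑ (g x) F + (∑[ y ← L ] ∑ (g y) F) ∎

  ∑-swap : ∀ (G : A → B → ℕ) (Ds : List A) (L : List B) →
    ∑[ I ← Ds ] ∑[ w ← L ] G I w ≡ ∑[ w ← L ] ∑[ I ← Ds ] G I w
  ∑-swap G [] L = sym (∑-zero L)
  ∑-swap G (I ∷ Ds) L rewrite ∑-swap G Ds L =
    sym (∑-+ (G I) (λ w → ∑[ J ← Ds ] G J w) L)

sumBelow : ℕ → (ℕ → ℕ) → ℕ
sumBelow zero F = 0
sumBelow (suc N) F = F 0 + sumBelow N (λ ℓ → F (suc ℓ))

sumBelow-cong : ∀ N {F G} → (∀ ℓ → F ℓ ≡ G ℓ) → sumBelow N F ≡ sumBelow N G
sumBelow-cong zero e = refl
sumBelow-cong (suc N) e = cong₂ _+_ (e 0) (sumBelow-cong N (λ ℓ → e (suc ℓ)))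

sumBelow-zero : ∀ N → sumBelow N (λ _ → 0) ≡ 0
sumBelow-zero zero = refl
sumBelow-zero (suc N) = sumBelow-zero N

sumBelow-+ : ∀ N F G → sumBelow N (λ ℓ → F ℓ + G ℓ) ≡ sumBelow N F + sumBelow N G
sumBelow-+ zero F G = refl
sumBelow-+ (suc N) F G rewrite sumBelow-+ N (λ ℓ → F (suc ℓ)) (λ ℓ → G (suc ℓ)) =
  +-interchange (F 0) (G 0) (sumBelow N (λ ℓ → F (suc ℓ))) (sumBelow N (λ ℓ → G (suc ℓ)))

sumBelow-*ˡ : ∀ a N F → sumBelow N (λ ℓ → a * F ℓ) ≡ a * sumBelow N F
sumBelow-*ˡ a zero F = sym (*-zeroʳ a)
sumBelow-*ˡ a (suc N) F rewrite sumBelow-*ˡ a N (λ ℓ → F (suc ℓ)) =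
  sym (*-distribˡ-+ a (F 0) _)

∑-upTo : ∀ F N → ∑ (upTo N) F ≡ sumBelow N F
∑-upTo F N = ∑-applyUpTo F (λ x → x) N
  where
  ∑-applyUpTo : ∀ F g N → ∑ (applyUpTo g N) F ≡ sumBelow N (λ ℓ → F (g ℓ))
  ∑-applyUpTo F g zero = refl
  ∑-applyUpTo F g (suc N) = cong (F (g 0) +_) (∑-applyUpTo F (λ ℓ → g (suc ℓ)) N)

sumBelow-even : ∀ n F → (∀ j → F (suc (2 * j)) ≡ 0) →
  sumBelow (suc n) F ≡ sumBelow (suc (n / 2)) (λ j → F (2 * j))
sumBelow-even zero F odd0 = refl
sumBelow-even (suc zero) F odd0 = cong (F 0 +_) (cong (_+ 0) (odd0 0))
sumBelow-even (suc (suc n)) F odd0 = begin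
  F 0 + (F 1 + sumBelow (suc n) F₂)
    ≡⟨ cong (F 0 +_) (cong (_+ sumBelow (suc n) F₂) (odd0 0)) ⟩
  F 0 + sumBelow (suc n) F₂
    ≡⟨ cong (F 0 +_) (sumBelow-even n F₂ (λ j → trans (cong (λ k → F (suc k)) (sym (*-suc 2 j))) (odd0 (suc j)))) ⟩
  F 0 + sumBelow (suc (n / 2)) (λ j → F (2 + 2 * j))
    ≡⟨ cong (F 0 +_) (sumBelow-cong (suc (n / 2)) (λ j → cong F (sym (*-suc 2 j)))) ⟩
  sumBelow (suc (suc (n / 2))) (λ j → F (2 * j))
    ≡⟨ cong (λ k → sumBelow (suc k) (λ j → F (2 * j))) (sym (m/n≡1+[m∸n]/n {suc (suc n)} {2} (s≤s (s≤s z≤n)))) ⟩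
  sumBelow (suc (suc (suc n) / 2)) (λ j → F (2 * j)) ∎
  where
  F₂ : ℕ → ℕ
  F₂ ℓ = F (2 + ℓ)

Series : Set
Series = ℕ → ℕ

infix 4 _≈_

_≈_ : Series → Series → Set
f ≈ g = ∀ m → f m ≡ g m

𝟘 𝟙 : Series
𝟘 _ = 0
𝟙 zero = 1
𝟙 (suc _) = 0

-- The diagonal of a family of series: diagonal Φ m = Σ_{ℓ ≤ m} Φ_ℓ(m - ℓ), i.e. the
-- series Σ_ℓ x^ℓ Φ_ℓ(x).  It unfolds as  Φ_0(m+1) + diagonal (Φ ∘ suc) m.
diagonal : (ℕ → Series) → Series
diagonal Φ m = sumBelow (suc m) (λ ℓ → Φ ℓ (m ∸ ℓ))

infixl 7 _⊛_
_⊛_ : Series → Series → Series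
f ⊛ g = diagonal (λ k j → f k * g j)

-- geo c Y = Y / (1 - c x):  coefficients  geo c Y m = Σ_{k ≤ m} c^k Y(m - k).
geo : ℕ → Series → Series
geo c Y zero = Y zero
geo c Y (suc m) = Y (suc m) + c * geo c Y m

diagonal-cong : ∀ {Φ Ψ : ℕ → Series} → (∀ ℓ → Φ ℓ ≈ Ψ ℓ) → diagonal Φ ≈ diagonal Ψ
diagonal-cong e m = sumBelow-cong (suc m) (λ ℓ → e ℓ (m ∸ ℓ))

diagonal-𝟘 : diagonal (λ _ → 𝟘) ≈ 𝟘
diagonal-𝟘 m = sumBelow-zero (suc m)

diagonal-+ : ∀ Φ Ψ → diagonal (λ ℓ m → Φ ℓ m + Ψ ℓ m) ≈ λ m → diagonal Φ m + diagonal Ψ m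
diagonal-+ Φ Ψ m = sumBelow-+ (suc m) (λ ℓ → Φ ℓ (m ∸ ℓ)) (λ ℓ → Ψ ℓ (m ∸ ℓ))

diagonal-*ˡ : ∀ a Φ → diagonal (λ ℓ m → a * Φ ℓ m) ≈ λ m → a * diagonal Φ m
diagonal-*ˡ a Φ m = sumBelow-*ˡ a (suc m) (λ ℓ → Φ ℓ (m ∸ ℓ))

⊛-cong : ∀ {f f' g g'} → f ≈ f' → g ≈ g' → f ⊛ g ≈ f' ⊛ g'
⊛-cong ff gg = diagonal-cong (λ k j → cong₂ _*_ (ff k) (gg j))

⊛-linearˡ : ∀ f g a B → (λ k → f k + a * g k) ⊛ B ≈ λ m → (f ⊛ B) m + a * (g ⊛ B) m
⊛-linearˡ f g a B m = begin
  ((λ k → f k + a * g k) ⊛ B) m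
    ≡⟨ diagonal-cong (λ k j → distrib (f k) (g k) a (B j)) m ⟩
  diagonal (λ k j → f k * B j + a * (g k * B j)) m
    ≡⟨ diagonal-+ (λ k j → f k * B j) (λ k j → a * (g k * B j)) m ⟩
  (f ⊛ B) m + diagonal (λ k j → a * (g k * B j)) m
    ≡⟨ cong ((f ⊛ B) m +_) (diagonal-*ˡ a (λ k j → g k * B j) m) ⟩
  (f ⊛ B) m + a * (g ⊛ B) m ∎
  where
  distrib : ∀ x y a b → (x + a * y) * b ≡ x * b + a * (y * b)
  distrib = solve-∀

𝟙-⊛ : ∀ B → 𝟙 ⊛ B ≈ B
𝟙-⊛ B zero = trans (+-identityʳ (1 * B 0)) (*-identityˡ (B 0))
𝟙-⊛ B (suc m) = trans (cong₂ _+_ (*-identityˡ (B (suc m))) (diagonal-𝟘 m)) (+-identityʳ _)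

geo-cong : ∀ c {Y Z} → Y ≈ Z → geo c Y ≈ geo c Z
geo-cong c e zero = e 0
geo-cong c e (suc m) = cong₂ _+_ (e (suc m)) (cong (c *_) (geo-cong c e m))

geo-𝟘 : ∀ c → geo c 𝟘 ≈ 𝟘
geo-𝟘 c zero = refl
geo-𝟘 c (suc m) rewrite geo-𝟘 c m = *-zeroʳ c

geo-by-0 : ∀ Y → geo 0 Y ≈ Y
geo-by-0 Y zero = refl
geo-by-0 Y (suc m) = +-identityʳ _

geo-+ : ∀ c Y Z → geo c (λ m → Y m + Z m) ≈ λ m → geo c Y m + geo c Z m
geo-+ c Y Z zero = refl
geo-+ c Y Z (suc m) rewrite geo-+ c Y Z m = regroup (Y (suc m)) (Z (suc m)) c (geo c Y m) (geo c Z m)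
  where
  regroup : ∀ a b c x y → a + b + c * (x + y) ≡ a + c * x + (b + c * y)
  regroup = solve-∀

geo-*ˡ : ∀ c a Y → geo c (λ m → a * Y m) ≈ λ m → a * geo c Y m
geo-*ˡ c a Y zero = refl
geo-*ˡ c a Y (suc m) rewrite geo-*ˡ c a Y m = regroup a (Y (suc m)) c (geo c Y m)
  where
  regroup : ∀ a y c g → a * y + c * (a * g) ≡ a * (y + c * g)
  regroup = solve-∀

geo-if : ∀ c b Y → geo c (λ m → if b then Y m else 0) ≈ λ m → if b then geo c Y m else 0
geo-if c true Y m = refl
geo-if c false Y m = geo-𝟘 c m

geo-∑ : ∀ {A : Set} c (Y : A → Series) L → geo c (λ m → ∑[ x ← L ] Y x m) ≈ λ m → ∑[ x ← L ] geo c (Y x) m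
geo-∑ c Y [] m = geo-𝟘 c m
geo-∑ c Y (x ∷ L) m rewrite sym (geo-∑ c Y L m) = geo-+ c (Y x) (λ m' → ∑[ y ← L ] Y y m') m

geo-diagonal-split : ∀ c N j →
  geo c (diagonal N) (suc j) ≡ geo c (N 0) (suc j) + geo c (diagonal (λ ℓ → N (suc ℓ))) j
geo-diagonal-split c N zero = regroup (N 0 1) (N 1 0) c (N 0 0)
  where
  regroup : ∀ a b c d → a + (b + 0) + c * (d + 0) ≡ a + c * d + (b + 0)
  regroup = solve-∀
geo-diagonal-split c N (suc j) rewrite geo-diagonal-split c N j =
  regroup (N 0 (suc (suc j))) (diagonal (λ ℓ → N (suc ℓ)) (suc j)) c
          (geo c (N 0) (suc j)) (geo c (diagonal (λ ℓ → N (suc ℓ))) j)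
  where
  regroup : ∀ a b c x y → a + b + c * (x + y) ≡ a + c * x + (b + c * y)
  regroup = solve-∀

diagonal-geo : ∀ c N → diagonal (λ ℓ → geo c (N ℓ)) ≈ geo c (diagonal N)
diagonal-geo c N zero = refl
diagonal-geo c N (suc m) = begin
  geo c (N 0) (suc m) + diagonal (λ ℓ → geo c (N (suc ℓ))) m
    ≡⟨ cong (geo c (N 0) (suc m) +_) (diagonal-geo c (λ ℓ → N (suc ℓ)) m) ⟩
  geo c (N 0) (suc m) + geo c (diagonal (λ ℓ → N (suc ℓ))) m
    ≡⟨ sym (geo-diagonal-split c N m) ⟩
  geo c (diagonal N) (suc m) ∎

geo-⊛ʳ : ∀ c A B → A ⊛ geo c B ≈ geo c (A ⊛ B)
geo-⊛ʳ c A B m = begin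
  (A ⊛ geo c B) m
    ≡⟨ diagonal-cong (λ k j → sym (geo-*ˡ c (A k) B j)) m ⟩
  diagonal (λ k → geo c (λ j → A k * B j)) m
    ≡⟨ diagonal-geo c (λ k j → A k * B j) m ⟩
  geo c (A ⊛ B) m ∎

geo-⊛ˡ : ∀ c A B → geo c A ⊛ B ≈ geo c (A ⊛ B)
geo-⊛ˡ c A B zero = refl
geo-⊛ˡ c A B (suc m) = begin
  A 0 * B (suc m) + ((λ k → A (suc k) + c * geo c A k) ⊛ B) m
    ≡⟨ cong (A 0 * B (suc m) +_) (⊛-linearˡ (λ k → A (suc k)) (geo c A) c B m) ⟩
  A 0 * B (suc m) + (((λ k → A (suc k)) ⊛ B) m + c * (geo c A ⊛ B) m)
    ≡⟨ cong (λ z → A 0 * B (suc m) + (((λ k → A (suc k)) ⊛ B) m + c * z)) (geo-⊛ˡ c A B m) ⟩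
  A 0 * B (suc m) + (((λ k → A (suc k)) ⊛ B) m + c * geo c (A ⊛ B) m)
    ≡⟨ sym (+-assoc (A 0 * B (suc m)) _ _) ⟩
  geo c (A ⊛ B) (suc m) ∎

∏ : ℕ → (ℕ → Series) → Series
∏ zero S = 𝟙
∏ (suc N) S = S 0 ⊛ ∏ N (λ r → S (suc r))

∏-cong : ∀ N {S S'} → (∀ r → S r ≈ S' r) → ∏ N S ≈ ∏ N S'
∏-cong zero e m = refl
∏-cong (suc N) e = ⊛-cong (e 0) (∏-cong N (λ r → e (suc r)))

∏-𝟙 : ∀ N → ∏ N (λ _ → 𝟙) ≈ 𝟙
∏-𝟙 zero m = refl
∏-𝟙 (suc N) m = trans (⊛-cong {𝟙} (λ _ → refl) (∏-𝟙 N) m) (𝟙-⊛ 𝟙 m)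

geo-into-∏ : ∀ N (S S' : ℕ → Series) x c →
  (∀ r → r ≢ x → S' r ≈ S r) → S' x ≈ geo c (S x) → (N ≤ x → c ≡ 0) →
  ∏ N S' ≈ geo c (∏ N S)
geo-into-∏ zero S S' x c others factor-x c≡0 m rewrite c≡0 z≤n = sym (geo-by-0 𝟙 m)
geo-into-∏ (suc N) S S' zero c others factor-x c≡0 m = begin
  (S' 0 ⊛ ∏ N (λ r → S' (suc r))) m
    ≡⟨ ⊛-cong factor-x (∏-cong N (λ r → others (suc r) (λ ()))) m ⟩
  (geo c (S 0) ⊛ ∏ N (λ r → S (suc r))) m
    ≡⟨ geo-⊛ˡ c (S 0) _ m ⟩
  geo c (∏ (suc N) S) m ∎
geo-into-∏ (suc N) S S' (suc x) c others factor-x c≡0 m = begin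
  (S' 0 ⊛ ∏ N (λ r → S' (suc r))) m
    ≡⟨ ⊛-cong (others 0 (λ ())) (geo-into-∏ N (λ r → S (suc r)) (λ r → S' (suc r)) x c
          (λ r r≢x → others (suc r) (λ e → r≢x (suc-injective e))) factor-x (λ N≤x → c≡0 (s≤s N≤x))) m ⟩
  (S 0 ⊛ geo c (∏ N (λ r → S (suc r)))) m
    ≡⟨ geo-⊛ʳ c (S 0) _ m ⟩
  geo c (∏ (suc N) S) m ∎

compProduct : (ℕ → ℕ → ℕ) → List ℕ → ℕ
compProduct g ks = product (map (λ r → g r (at ks r)) (upTo (length ks)))

compProduct-cons : ∀ g k ks → compProduct g (k ∷ ks) ≡ g 0 k * compProduct (λ r → g (suc r)) ks
compProduct-cons g k ks = cong (g 0 k *_) (trans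
  (cong product (map-applyUpTo suc (λ r → g r (at (k ∷ ks) r)) (length ks)))
  (sym (cong product (map-applyUpTo (λ x → x) (λ r → g (suc r) (at ks r)) (length ks)))))

∏-coefficient : ∀ N g m → ∑ (weakComps N m) (compProduct g) ≡ ∏ N g m
∏-coefficient zero g zero = refl
∏-coefficient zero g (suc m) = refl
∏-coefficient (suc N) g m = begin
  ∑ (concatMap (λ k → map (k ∷_) (weakComps N (m ∸ k))) (upTo (suc m))) (compProduct g)
    ≡⟨ ∑-concatMap (compProduct g) (λ k → map (k ∷_) (weakComps N (m ∸ k))) (upTo (suc m)) ⟩
  ∑[ k ← upTo (suc m) ] ∑ (map (k ∷_) (weakComps N (m ∸ k))) (compProduct g)
    ≡⟨ ∑-cong (upTo (suc m)) first-part ⟩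
  ∑[ k ← upTo (suc m) ] g 0 k * ∏ N g' (m ∸ k)
    ≡⟨ ∑-upTo (λ k → g 0 k * ∏ N g' (m ∸ k)) (suc m) ⟩
  ∏ (suc N) g m ∎
  where
  g' : ℕ → ℕ → ℕ
  g' r = g (suc r)
  first-part : ∀ k → ∑ (map (k ∷_) (weakComps N (m ∸ k))) (compProduct g) ≡ g 0 k * ∏ N g' (m ∸ k)
  first-part k = begin
    ∑ (map (k ∷_) (weakComps N (m ∸ k))) (compProduct g)
      ≡⟨ ∑-map (compProduct g) (k ∷_) (weakComps N (m ∸ k)) ⟩
    ∑[ ks ← weakComps N (m ∸ k) ] compProduct g (k ∷ ks)
      ≡⟨ ∑-cong (weakComps N (m ∸ k)) (compProduct-cons g k) ⟩
    ∑[ ks ← weakComps N (m ∸ k) ] g 0 k * compProduct g' ks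
      ≡⟨ ∑-*ˡ (g 0 k) (compProduct g') (weakComps N (m ∸ k)) ⟩
    g 0 k * ∑ (weakComps N (m ∸ k)) (compProduct g')
      ≡⟨ cong (g 0 k *_) (∏-coefficient N g' (m ∸ k)) ⟩
    g 0 k * ∏ N g' (m ∸ k) ∎

-- The negative binomial series (1 - c x)^(-i) = Σ_k C(k+i-1, k) c^k x^k.
negBinom : ℕ → ℕ → Series
negBinom c i k = multichoose k i * c ^ k

negBinom-0 : ∀ c → negBinom c 0 ≈ 𝟙
negBinom-0 c zero = refl
negBinom-0 c (suc k) = refl

-- Pascal's rule for multiset coefficients, also valid for i = 0 by the convention.
multichoose-pascal : ∀ k i → multichoose (suc k) (suc i) ≡ multichoose (suc k) i + multichoose k (suc i)
multichoose-pascal k zero rewrite +-identityʳ k = trans (nCn≡1 (suc k)) (sym (nCn≡1 k))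
multichoose-pascal k (suc i) = begin
  suc (k + suc i) C suc k                   ≡⟨ sym (nCk+nC[k+1]≡[n+1]C[k+1] (k + suc i) k) ⟩
  (k + suc i) C k + (k + suc i) C suc k     ≡⟨ +-comm ((k + suc i) C k) _ ⟩
  (k + suc i) C suc k + (k + suc i) C k     ≡⟨ cong (λ z → z C suc k + (k + suc i) C k) (+-suc k i) ⟩
  suc (k + i) C suc k + (k + suc i) C k     ∎

negBinom-suc : ∀ c i → geo c (negBinom c i) ≈ negBinom c (suc i)
negBinom-suc c zero zero = refl
negBinom-suc c (suc i) zero = refl
negBinom-suc c i (suc k) = begin
  multichoose (suc k) i * c ^ suc k + c * geo c (negBinom c i) k
    ≡⟨ cong (λ z → multichoose (suc k) i * c ^ suc k + c * z) (negBinom-suc c i k) ⟩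
  multichoose (suc k) i * c ^ suc k + c * (multichoose k (suc i) * c ^ k)
    ≡⟨ collect (multichoose (suc k) i) (multichoose k (suc i)) c (c ^ k) ⟩
  (multichoose (suc k) i + multichoose k (suc i)) * c ^ suc k
    ≡⟨ cong (_* c ^ suc k) (sym (multichoose-pascal k i)) ⟩
  multichoose (suc k) (suc i) * c ^ suc k ∎
  where
  collect : ∀ a b c p → a * (c * p) + c * (b * p) ≡ (a + b) * (c * p)
  collect = solve-∀

≡ᵇ-refl : ∀ n → (n ≡ᵇ n) ≡ true
≡ᵇ-refl zero = refl
≡ᵇ-refl (suc n) = ≡ᵇ-refl n

≡ᵇ-≢ : ∀ m n → m ≢ n → (m ≡ᵇ n) ≡ false
≡ᵇ-≢ zero zero m≢n = ⊥-elim (m≢n refl)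
≡ᵇ-≢ zero (suc n) m≢n = refl
≡ᵇ-≢ (suc m) zero m≢n = refl
≡ᵇ-≢ (suc m) (suc n) m≢n = ≡ᵇ-≢ m n (λ e → m≢n (cong suc e))

countEq-here : ∀ x xs → countEq x (x ∷ xs) ≡ suc (countEq x xs)
countEq-here x xs rewrite ≡ᵇ-refl x = refl

countEq-other : ∀ r x xs → r ≢ x → countEq r (x ∷ xs) ≡ countEq r xs
countEq-other r x xs r≢x rewrite ≡ᵇ-≢ r x r≢x = refl

countEq-above-max : ∀ r xs → maxL xs < r → countEq r xs ≡ 0
countEq-above-max r [] _ = refl
countEq-above-max r (x ∷ xs) max<r with r ≡ᵇ x in e
... | true = ⊥-elim (<-irrefl (sym (≡ᵇ⇒≡ r x (subst T (sym e) tt))) (≤-<-trans (m≤m⊔n x (maxL xs)) max<r))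
... | false = countEq-above-max r xs (≤-<-trans (m≤n⊔m x (maxL xs)) max<r)

at-applyUpTo-< : ∀ (f : ℕ → ℕ) N r → r < N → at (applyUpTo f N) r ≡ f r
at-applyUpTo-< f (suc N) zero _ = refl
at-applyUpTo-< f (suc N) (suc r) (s≤s r<N) = at-applyUpTo-< (λ x → f (suc x)) N r r<N

at-applyUpTo-≥ : ∀ (f : ℕ → ℕ) N r → N ≤ r → at (applyUpTo f N) r ≡ 0
at-applyUpTo-≥ f zero r _ = refl
at-applyUpTo-≥ f (suc N) (suc r) (s≤s N≤r) = at-applyUpTo-≥ (λ x → f (suc x)) N r N≤r

at-beyond : ∀ (xs : List ℕ) r → length xs ≤ r → at xs r ≡ 0
at-beyond [] r _ = refl
at-beyond (a ∷ xs) (suc r) (s≤s len≤r) = at-beyond xs r len≤r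

at-counts : ∀ L r → at (map (λ k → countEq k L) (upTo (suc (maxL L)))) r ≡ countEq r L
at-counts L r rewrite map-applyUpTo (λ x → x) (λ k → countEq k L) (suc (maxL L)) with r <? suc (maxL L)
... | yes r<len = at-applyUpTo-< (λ k → countEq k L) (suc (maxL L)) r r<len
... | no r≮len = trans (at-applyUpTo-≥ (λ k → countEq k L) (suc (maxL L)) r (≮⇒≥ r≮len))
                       (sym (countEq-above-max r L (≮⇒≥ r≮len)))

frame-at : ∀ w r → at (frame w) r ≡ countEq r (vertexHeights 0 w)
frame-at w = at-counts (vertexHeights 0 w)

eqList-refl : ∀ x → eqList x x ≡ true
eqList-refl [] = refl
eqList-refl (a ∷ x) rewrite ≡ᵇ-refl a = eqList-refl x

eqList-sound : ∀ x y → eqList x y ≡ true → x ≡ y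
eqList-sound [] [] _ = refl
eqList-sound (a ∷ x) (b ∷ y) e with a ≡ᵇ b in a≡ᵇb
... | true = cong₂ _∷_ (≡ᵇ⇒≡ a b (subst T (sym a≡ᵇb) tt)) (eqList-sound x y e)
eqList-sound [] (b ∷ y) ()
eqList-sound (a ∷ x) [] ()

indicator : List ℕ → List ℕ → ℕ
indicator a I = if eqList a I then 1 else 0

multiplicity : List ℕ → List (List ℕ) → ℕ
multiplicity a Ds = ∑ Ds (indicator a)

without : List ℕ → List (List ℕ) → List (List ℕ)
without x = filterᵇ (λ y → if eqList x y then false else true)

multiplicity-without-self : ∀ a R → multiplicity a (without a R) ≡ 0
multiplicity-without-self a [] = refl
multiplicity-without-self a (y ∷ R) with eqList a y in e
... | true = multiplicity-without-self a R
... | false rewrite e = multiplicity-without-self a R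

multiplicity-without-other : ∀ a x R → eqList a x ≡ false → multiplicity a (without x R) ≡ multiplicity a R
multiplicity-without-other a x [] _ = refl
multiplicity-without-other a x (y ∷ R) a≠x with eqList x y in e
... | true rewrite sym (eqList-sound x y e) | a≠x = multiplicity-without-other a x R a≠x
... | false = cong (indicator a y +_) (multiplicity-without-other a x R a≠x)

multiplicity-dedup : ∀ a Ks → a ∈ Ks → multiplicity a (dedup Ks) ≡ 1
multiplicity-dedup a (x ∷ Ks) a∈ with eqList a x in e
... | true rewrite eqList-sound a x e = cong suc (multiplicity-without-self x (dedup Ks))
multiplicity-dedup a (x ∷ Ks) (here refl) | false rewrite eqList-refl a with e
... | ()
multiplicity-dedup a (x ∷ Ks) (there a∈) | false =
  trans (multiplicity-without-other a x (dedup Ks) e) (multiplicity-dedup a Ks a∈)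

module _ {A : Set} (key : A → List ℕ) (f : List ℕ → ℕ) where

  fibreSize : List A → List ℕ → ℕ
  fibreSize L I = length (filterᵇ (λ w → eqList (key w) I) L)

  fibre-sum : ∀ L → ∑[ I ← dedup (map key L) ] fibreSize L I * f I ≡ ∑[ w ← L ] f (key w)
  fibre-sum L = begin
    ∑[ I ← Ds ] fibreSize L I * f I
      ≡⟨ ∑-cong Ds (λ I → trans (*-comm (fibreSize L I) (f I)) (expand I)) ⟩
    ∑[ I ← Ds ] ∑[ w ← L ] f I * indicator (key w) I
      ≡⟨ ∑-swap (λ I w → f I * indicator (key w) I) Ds L ⟩
    ∑[ w ← L ] ∑[ I ← Ds ] f I * indicator (key w) I
      ≡⟨ ∑-cong∈ L (λ w w∈L → collapse w (∈-map⁺ key w∈L)) ⟩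
    ∑[ w ← L ] f (key w) ∎
    where
    Ds = dedup (map key L)

    expand : ∀ I → f I * fibreSize L I ≡ ∑[ w ← L ] f I * indicator (key w) I
    expand I = trans (cong (f I *_) (length-filter (λ w → eqList (key w) I) L))
                     (sym (∑-*ˡ (f I) (λ w → indicator (key w) I) L))

    indicator-subst : ∀ a I → f I * indicator a I ≡ f a * indicator a I
    indicator-subst a I with eqList a I in e
    ... | true rewrite eqList-sound a I e = refl
    ... | false = trans (*-zeroʳ (f I)) (sym (*-zeroʳ (f a)))

    collapse : ∀ w → key w ∈ map key L → ∑[ I ← Ds ] f I * indicator (key w) I ≡ f (key w)
    collapse w k∈ = begin
      ∑[ I ← Ds ] f I * indicator (key w) I      ≡⟨ ∑-cong Ds (indicator-subst (key w)) ⟩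
      ∑[ I ← Ds ] f (key w) * indicator (key w) I ≡⟨ ∑-*ˡ (f (key w)) (indicator (key w)) Ds ⟩
      f (key w) * multiplicity (key w) Ds         ≡⟨ cong (f (key w) *_) (multiplicity-dedup (key w) (map key L) k∈) ⟩
      f (key w) * 1                               ≡⟨ *-identityʳ (f (key w)) ⟩
      f (key w) ∎

-- A function of the height h - 1 of the vertex after a down step, read as 0 at h = 0.
below : (ℕ → ℕ) → ℕ → ℕ
below F zero = 0
below F (suc h) = F h

below-cong : ∀ {F G} → (∀ x → F x ≡ G x) → ∀ h → below F h ≡ below G h
below-cong e zero = refl
below-cong e (suc h) = e h

∑-below : ∀ {A : Set} (F : ℕ → A → ℕ) L h → ∑[ x ← L ] below (λ h' → F h' x) h ≡ below (λ h' → ∑ L (F h')) h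
∑-below F L zero = ∑-zero L
∑-below F L (suc h) = refl

-- Height after one step (a step down from 0 never occurs in a valid path).
heightAfter : ℕ → Step → ℕ
heightAfter h U = suc h
heightAfter h H = h
heightAfter h D = h ∸ 1

vertexHeights-cons : ∀ h s w → vertexHeights h (s ∷ w) ≡ h ∷ vertexHeights (heightAfter h s) w
vertexHeights-cons h U w = refl
vertexHeights-cons h H w = refl
vertexHeights-cons h D w = refl

module Insertion (c : ℕ → ℕ) where

  -- Π over the vertices v of a path started at height h of 1/(1 - c_{ht v} x):
  -- its coefficient of x^m counts the coloured ways to insert m horizontal steps.
  ins : ℕ → List Step → Series
  ins h [] = geo (c h) 𝟙
  ins h (s ∷ w) = geo (c h) (ins (heightAfter h s) w)

  module _ (N : ℕ) (vanish : ∀ x → N ≤ x → c x ≡ 0) where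

    heightProduct : List ℕ → Series
    heightProduct L = ∏ N (λ r → negBinom (c r) (countEq r L))

    heightProduct-[] : heightProduct [] ≈ 𝟙
    heightProduct-[] m = trans (∏-cong N (λ r → negBinom-0 (c r)) m) (∏-𝟙 N m)

    heightProduct-∷ : ∀ h L → heightProduct (h ∷ L) ≈ geo (c h) (heightProduct L)
    heightProduct-∷ h L = geo-into-∏ N (λ r → negBinom (c r) (countEq r L))
      (λ r → negBinom (c r) (countEq r (h ∷ L))) h (c h)
      (λ r r≢h k → cong (λ i → negBinom (c r) i k) (countEq-other r h L r≢h))
      (λ k → trans (cong (λ i → negBinom (c h) i k) (countEq-here h L)) (sym (negBinom-suc (c h) (countEq h L) k)))
      (vanish h)

    ins-product : ∀ h w → ins h w ≈ heightProduct (vertexHeights h w)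
    ins-product h [] m = sym (trans (heightProduct-∷ h [] m) (geo-cong (c h) heightProduct-[] m))
    ins-product h (s ∷ w) m = begin
      geo (c h) (ins (heightAfter h s) w) m
        ≡⟨ geo-cong (c h) (ins-product (heightAfter h s) w) m ⟩
      geo (c h) (heightProduct (vertexHeights (heightAfter h s) w)) m
        ≡⟨ sym (heightProduct-∷ h _ m) ⟩
      heightProduct (h ∷ vertexHeights (heightAfter h s) w) m
        ≡⟨ cong (λ L → heightProduct L m) (sym (vertexHeights-cons h s w)) ⟩
      heightProduct (vertexHeights h (s ∷ w)) m ∎

if-* : ∀ b a x → (if b then a * x else 0) ≡ a * (if b then x else 0)
if-* true a x = refl
if-* false a x = sym (*-zeroʳ a)

odd : ℕ → Bool
odd zero = false
odd (suc n) = not (odd n)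

odd-double : ∀ j → odd (2 * j) ≡ false
odd-double zero = refl
odd-double (suc j) = trans (cong odd (*-suc 2 j)) (trans (not-involutive (odd (2 * j))) (odd-double j))

module Counting (hs : List ℕ) where
  open Insertion (at hs)

  c : ℕ → ℕ
  c = at hs

  wordSum : ℕ → (List Step → ℕ) → ℕ
  wordSum ℓ F = ∑ (allWords ℓ) F

  wordSum-suc : ∀ ℓ F → wordSum (suc ℓ) F ≡ wordSum ℓ (λ w → F (U ∷ w) + (F (H ∷ w) + (F (D ∷ w) + 0)))
  wordSum-suc ℓ F = ∑-concatMap F (λ w → (U ∷ w) ∷ (H ∷ w) ∷ (D ∷ w) ∷ []) (allWords ℓ)

  motzkinWeight : ℕ → List Step → ℕ
  motzkinWeight h w = if validFrom h w then colorings hs h w else 0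

  M : ℕ → ℕ → ℕ
  M h n = wordSum n (motzkinWeight h)

  motzkinWeight-step : ∀ h w →
    motzkinWeight h (U ∷ w) + (motzkinWeight h (H ∷ w) + (motzkinWeight h (D ∷ w) + 0))
      ≡ motzkinWeight (suc h) w + (c h * motzkinWeight h w + below (λ h' → motzkinWeight h' w) h)
  motzkinWeight-step h w =
    cong₂ (λ x y → motzkinWeight (suc h) w + (x + y)) (if-* (validFrom h w) (c h) (colorings hs h w)) (down h)
    where
    down : ∀ h → motzkinWeight h (D ∷ w) + 0 ≡ below (λ h' → motzkinWeight h' w) h
    down zero = refl
    down (suc h) = +-identityʳ _

  M-suc : ∀ h n → M h (suc n) ≡ M (suc h) n + (c h * M h n + below (λ h' → M h' n) h)
  M-suc h n = begin
    M h (suc n)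
      ≡⟨ trans (wordSum-suc n (motzkinWeight h)) (∑-cong (allWords n) (motzkinWeight-step h)) ⟩
    wordSum n (λ w → motzkinWeight (suc h) w + (c h * motzkinWeight h w + below (λ h' → motzkinWeight h' w) h))
      ≡⟨ ∑-+ (motzkinWeight (suc h)) _ (allWords n) ⟩
    M (suc h) n + wordSum n (λ w → c h * motzkinWeight h w + below (λ h' → motzkinWeight h' w) h)
      ≡⟨ cong (M (suc h) n +_) (∑-+ (λ w → c h * motzkinWeight h w) _ (allWords n)) ⟩
    M (suc h) n + (wordSum n (λ w → c h * motzkinWeight h w) + wordSum n (λ w → below (λ h' → motzkinWeight h' w) h))
      ≡⟨ cong₂ (λ x y → M (suc h) n + (x + y)) (∑-*ˡ (c h) (motzkinWeight h) (allWords n))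
               (∑-below motzkinWeight (allWords n) h) ⟩
    M (suc h) n + (c h * M h n + below (λ h' → M h' n) h) ∎

  dyckWeight : ℕ → List Step → Series
  dyckWeight h w m = if validFrom h w ∧ noH w then ins h w m else 0

  Dd : ℕ → ℕ → Series
  Dd h ℓ m = wordSum ℓ (λ w → dyckWeight h w m)

  -- The empty path is a Dyck path only from height 0.
  startAt : ℕ → Series
  startAt zero = 𝟙
  startAt (suc h) = 𝟘

  -- What remains after the factor 1/(1 - c_h x) of the first vertex is removed.
  afterFirst : ℕ → ℕ → Series
  afterFirst h zero = startAt h
  afterFirst h (suc ℓ) m = Dd (suc h) ℓ m + below (λ h' → Dd h' ℓ m) h

  dyckWeight-step : ∀ h w m →
    dyckWeight h (U ∷ w) m + (dyckWeight h (H ∷ w) m + (dyckWeight h (D ∷ w) m + 0))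
      ≡ geo (c h) (λ m' → dyckWeight (suc h) w m' + below (λ h' → dyckWeight h' w m') h) m
  dyckWeight-step h w m = begin
    dyckWeight h (U ∷ w) m + (dyckWeight h (H ∷ w) m + (dyckWeight h (D ∷ w) m + 0))
      ≡⟨ cong₂ (λ x y → x + (y + (dyckWeight h (D ∷ w) m + 0)))
               (sym (geo-if (c h) (validFrom (suc h) w ∧ noH w) (ins (suc h) w) m))
               (cong (if_then ins h (H ∷ w) m else 0) (∧-zeroʳ (validFrom h w))) ⟩
    geo (c h) (dyckWeight (suc h) w) m + (dyckWeight h (D ∷ w) m + 0)
      ≡⟨ cong (geo (c h) (dyckWeight (suc h) w) m +_) (down h) ⟩
    geo (c h) (dyckWeight (suc h) w) m + geo (c h) (λ m' → below (λ h' → dyckWeight h' w m') h) m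
      ≡⟨ sym (geo-+ (c h) (dyckWeight (suc h) w) _ m) ⟩
    geo (c h) (λ m' → dyckWeight (suc h) w m' + below (λ h' → dyckWeight h' w m') h) m ∎
    where
    down : ∀ h → dyckWeight h (D ∷ w) m + 0 ≡ geo (c h) (λ m' → below (λ h' → dyckWeight h' w m') h) m
    down zero = sym (geo-𝟘 (c 0) m)
    down (suc h) = trans (+-identityʳ _) (sym (geo-if (c (suc h)) (validFrom h w ∧ noH w) (ins h w) m))

  Dd-geo : ∀ h ℓ → Dd h ℓ ≈ geo (c h) (afterFirst h ℓ)
  Dd-geo zero zero m = +-identityʳ _
  Dd-geo (suc h) zero m = sym (geo-𝟘 (c (suc h)) m)
  Dd-geo h (suc ℓ) m = begin
    Dd h (suc ℓ) m
      ≡⟨ trans (wordSum-suc ℓ (λ w → dyckWeight h w m)) (∑-cong (allWords ℓ) (λ w → dyckWeight-step h w m)) ⟩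
    wordSum ℓ (λ w → geo (c h) (λ m' → dyckWeight (suc h) w m' + below (λ h' → dyckWeight h' w m') h) m)
      ≡⟨ sym (geo-∑ (c h) (λ w m' → dyckWeight (suc h) w m' + below (λ h' → dyckWeight h' w m') h) (allWords ℓ) m) ⟩
    geo (c h) (λ m' → wordSum ℓ (λ w → dyckWeight (suc h) w m' + below (λ h' → dyckWeight h' w m') h)) m
      ≡⟨ geo-cong (c h) (λ m' → trans (∑-+ (λ w → dyckWeight (suc h) w m') _ (allWords ℓ))
           (cong (Dd (suc h) ℓ m' +_) (∑-below (λ h' w → dyckWeight h' w m') (allWords ℓ) h))) m ⟩
    geo (c h) (afterFirst h (suc ℓ)) m ∎

  -- S h n = Σ_{ℓ ≤ n} [x^(n-ℓ)] Dd h ℓ: Dyck paths of length ℓ with n - ℓ insertions.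
  S : ℕ → ℕ → ℕ
  S h = diagonal (Dd h)

  -- Hence S has the same first-step recurrence as M.
  S-geo : ∀ h → S h ≈ geo (c h) (diagonal (afterFirst h))
  S-geo h m = trans (diagonal-cong (Dd-geo h) m) (diagonal-geo (c h) (afterFirst h) m)

  diagonal-afterFirst : ∀ h n → diagonal (afterFirst h) (suc n) ≡ S (suc h) n + below (λ h' → S h' n) h
  diagonal-afterFirst zero n =
    trans (diagonal-+ (Dd 1) (λ _ _ → 0) n) (cong (S 1 n +_) (diagonal-𝟘 n))
  diagonal-afterFirst (suc h) n = diagonal-+ (Dd (suc (suc h))) (Dd h) n

  S-suc : ∀ h n → S h (suc n) ≡ (S (suc h) n + below (λ h' → S h' n) h) + c h * S h n
  S-suc h n = begin
    S h (suc n)                                                          ≡⟨ S-geo h (suc n) ⟩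
    diagonal (afterFirst h) (suc n) + c h * geo (c h) (diagonal (afterFirst h)) n
      ≡⟨ cong₂ (λ x y → x + c h * y) (diagonal-afterFirst h n) (sym (S-geo h n)) ⟩
    (S (suc h) n + below (λ h' → S h' n) h) + c h * S h n ∎

  -- Both sides satisfy the same first-step recurrence and initial values.
  M≡S : ∀ n h → M h n ≡ S h n
  M≡S zero zero = refl
  M≡S zero (suc h) = refl
  M≡S (suc n) h = begin
    M h (suc n)                                                 ≡⟨ M-suc h n ⟩
    M (suc h) n + (c h * M h n + below (λ h' → M h' n) h)
      ≡⟨ cong₂ _+_ (M≡S n (suc h)) (cong₂ _+_ (cong (c h *_) (M≡S n h)) (below-cong (λ h' → M≡S n h') h)) ⟩
    S (suc h) n + (c h * S h n + below (λ h' → S h' n) h)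
      ≡⟨ rotate (S (suc h) n) (c h * S h n) (below (λ h' → S h' n) h) ⟩
    (S (suc h) n + below (λ h' → S h' n) h) + c h * S h n       ≡⟨ sym (S-suc h n) ⟩
    S h (suc n) ∎
    where
    rotate : ∀ a b d → a + (b + d) ≡ (a + d) + b
    rotate = solve-∀

  -- A Dyck path from height h returning to 0 has length ≡ h (mod 2).
  Dd-odd : ∀ ℓ h m → odd (h + ℓ) ≡ true → Dd h ℓ m ≡ 0
  Dd-odd zero zero m ()
  Dd-odd zero (suc h) m _ = refl
  Dd-odd (suc ℓ) h m odd-hℓ = trans (Dd-geo h (suc ℓ) m)
    (trans (geo-cong (c h) (λ m' → cong₂ _+_ (Dd-odd ℓ (suc h) m' odd-up) (down h odd-hℓ m')) m) (geo-𝟘 (c h) m))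
    where
    odd-up : odd (suc h + ℓ) ≡ true
    odd-up = trans (cong odd (sym (+-suc h ℓ))) odd-hℓ
    down : ∀ h → odd (h + suc ℓ) ≡ true → ∀ m' → below (λ h' → Dd h' ℓ m') h ≡ 0
    down zero _ m' = refl
    down (suc h) odd-h2ℓ m' = Dd-odd ℓ h m'
      (trans (sym (not-involutive (odd (h + ℓ)))) (trans (cong (λ z → not (odd z)) (sym (+-suc h ℓ))) odd-h2ℓ))

  -- Regrouping the Dyck paths of length ℓ by frame and expanding each insertion
  -- series as a product over heights gives the summand of the formula.
  dyck-by-frames : ∀ N → (∀ x → N ≤ x → c x ≡ 0) → ∀ ℓ m →
    ∑[ I ← frames ℓ ] pCount ℓ I * ∑ (weakComps N m) (innerTerm hs I) ≡ Dd 0 ℓ m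
  dyck-by-frames N vanish ℓ m = begin
    ∑[ I ← frames ℓ ] pCount ℓ I * ∑ (weakComps N m) (innerTerm hs I)
      ≡⟨ ∑-cong (frames ℓ) (λ I → cong (pCount ℓ I *_) (∏-coefficient N (frameFactor I) m)) ⟩
    ∑[ I ← frames ℓ ] pCount ℓ I * ∏ N (frameFactor I) m
      ≡⟨ fibre-sum frame (λ I → ∏ N (frameFactor I) m) (dyckPaths ℓ) ⟩
    ∑[ w ← dyckPaths ℓ ] ∏ N (frameFactor (frame w)) m
      ≡⟨ ∑-cong (dyckPaths ℓ) (λ w → trans
           (∏-cong N (λ r k → cong (λ i → negBinom (c r) i k) (frame-at w r)) m)
           (sym (ins-product N vanish 0 w m))) ⟩
    ∑[ w ← dyckPaths ℓ ] ins 0 w m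
      ≡⟨ ∑-filter (λ w → ins 0 w m) isDyck (allWords ℓ) ⟩
    Dd 0 ℓ m ∎
    where
    frameFactor : List ℕ → ℕ → Series
    frameFactor I r = negBinom (c r) (at I r)

mainTheorem19 : (n : ℕ) (hs : Vec ℕ (suc (n / 2))) →
    coloredMotzkin n (toList hs) ≡ formulaRHS n (toList hs)
mainTheorem19 n hs = begin
  coloredMotzkin n (toList hs)  ≡⟨ ∑-filter (colorings (toList hs) 0) isMotzkin (allWords n) ⟩
  M 0 n                         ≡⟨ M≡S n 0 ⟩
  S 0 n                         ≡⟨ sumBelow-even n (λ ℓ → Dd 0 ℓ (n ∸ ℓ)) odd-vanishes ⟩
  sumBelow (suc (n / 2)) (λ j → Dd 0 (2 * j) (n ∸ 2 * j))
    ≡⟨ sumBelow-cong (suc (n / 2)) (λ j → sym (dyck-by-frames (suc (n / 2)) vanish (2 * j) (n ∸ 2 * j))) ⟩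
  sumBelow (suc (n / 2)) (λ j → ∑[ I ← frames (2 * j) ] pCount (2 * j) I *
                                   ∑ (weakComps (suc (n / 2)) (n ∸ 2 * j)) (innerTerm (toList hs) I))
    ≡⟨ sym (∑-upTo _ (suc (n / 2))) ⟩
  formulaRHS n (toList hs) ∎
  where
  open Counting (toList hs)

  vanish : ∀ x → suc (n / 2) ≤ x → c x ≡ 0
  vanish x ν<x = at-beyond (toList hs) x (subst (_≤ x) (sym (length-toList hs)) ν<x)

  odd-vanishes : ∀ j → Dd 0 (suc (2 * j)) (n ∸ suc (2 * j)) ≡ 0
  odd-vanishes j = Dd-odd (suc (2 * j)) 0 _ (cong not (odd-double j))
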